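{- Let $A=(A_{ij})\in\mathrm{SL}_3(\mathbb{Z})$ with $A_{31}\neq0$ and $A_{21}A_{32}-A_{22}A_{31}\neq0$. Put $f=\gcd(A_{31},A_{32})$, $d_1=A_{31}/f$, $d_2=(A_{21}A_{32}-A_{22}A_{31})/f$, and for a $3\times3$ matrix $X$ write $M_{12}(X)=X_{11}X_{22}-X_{12}X_{21}$ (rows $1,2$, columns $1,2$) and $M_{13}(X)=X_{11}X_{32}-X_{12}X_{31}$ (rows $1,3$, columns $1,2$). Then for any integers $n_1,n_2,n_3,n_4$ there exist $u,u'\in U_3(\mathbb{Z})$ such that $A'=uAu'$ satisfies \[ \frac{A'_{32}}{f}=\frac{A_{32}}{f}+d_1n_1,\quad A'_{33}=A_{33}+fn_2,\quad M_{12}(A')=M_{12}(A)+fn_3,\quad \frac{M_{13}(A')}{f}=\frac{M_{13}(A)}{f}+d_2n_4. \]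
   Context: $U_3(\mathbb{Z})$ is the group of integral $3\times3$ upper triangular unipotent matrices. -}

module Defs where

open import Data.Fin using (Fin; zero; suc)
open import Data.Integer using (ℤ; _+_; _-_; _*_; 0ℤ; 1ℤ)
open import Data.Product using (_×_)
open import Relation.Binary.PropositionalEquality using (_≡_)

Mat3 : Set
Mat3 = Fin 3 → Fin 3 → ℤ

i1 i2 i3 : Fin 3
i1 = zero
i2 = suc zero
i3 = suc (suc zero)

_⊗_ : Mat3 → Mat3 → Mat3
(X ⊗ Y) i j = X i i1 * Y i1 j + X i i2 * Y i2 j + X i i3 * Y i3 j

det : Mat3 → ℤ
det X = X i1 i1 * (X i2 i2 * X i3 i3 - X i2 i3 * X i3 i2)
      - X i1 i2 * (X i2 i1 * X i3 i3 - X i2 i3 * X i3 i1)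
      + X i1 i3 * (X i2 i1 * X i3 i2 - X i2 i2 * X i3 i1)

IsSL3 : Mat3 → Set
IsSL3 X = det X ≡ 1ℤ

IsU3 : Mat3 → Set
IsU3 X = (X i1 i1 ≡ 1ℤ × X i2 i2 ≡ 1ℤ × X i3 i3 ≡ 1ℤ)
       × (X i2 i1 ≡ 0ℤ × X i3 i1 ≡ 0ℤ × X i3 i2 ≡ 0ℤ)

M12 : Mat3 → ℤ
M12 X = X i1 i1 * X i2 i2 - X i1 i2 * X i2 i1

M13 : Mat3 → ℤ
M13 X = X i1 i1 * X i3 i2 - X i1 i2 * X i3 i1

{-# OPTIONS --safe #-}
-- Left multiplication by u = [[1,a,b],[0,1,c],[0,0,1]] performs row operations and right
-- multiplication by u′ = [[1,x,y],[0,1,z],[0,0,1]] column operations. The latter keep the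
-- 2×2 minors in the first two columns, so M13 moves by a·M23 and M12 by c·M13 + (ac − b)·M23,
-- while the third row moves by x, y, z times its first two entries. Hence A32, A33 and M13 can be
-- shifted by any multiple of A31, of f = gcd(A31, A32) (Bézout) and of M23. For M12 one needs f
-- in the span of M13 and M23: writing f = σA31 + τA32 and ℓ(r) = σr₁ + τr₂ for a row r, the
-- Plücker relation ℓ(r₂)M13 − ℓ(r₁)M23 = ℓ(r₃)M12 and the cofactor expansion of det A = 1 along
-- the third column exhibit f as such a combination.
module Submission where

open import Defs
open import Data.Fin using (Fin; zero; suc)
open import Data.Integer using (ℤ; _+_; _-_; _*_; -_; 0ℤ; 1ℤ; -1ℤ; +_; -[1+_]; ∣_∣)
open import Data.Integer.GCD using (gcd)
open import Data.Integer.Properties using (*-identityˡ; *-identityʳ; -1*i≡-i; pos-+; pos-*; *-comm; *-assoc)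
open import Data.Integer.Tactic.RingSolver using (solve-∀)
import Data.Nat as ℕ
open import Data.Nat.GCD using (gcd-GCD; module Bézout)
open import Data.Product using (_×_; ∃-syntax; _,_)
open import Relation.Binary.PropositionalEquality using (_≡_; _≢_; refl; sym; trans; cong; cong₂; module ≡-Reasoning)
open ≡-Reasoning

∣i∣≡unit*i : ∀ i → ∃[ ε ] + ∣ i ∣ ≡ ε * i
∣i∣≡unit*i (+ n)    = 1ℤ , sym (*-identityˡ (+ n))
∣i∣≡unit*i -[1+ n ] = -1ℤ , sym (-1*i≡-i -[1+ n ])

ℕ-identity⇒ℤ : ∀ {d} x m y n → d ℕ.+ y ℕ.* n ≡ x ℕ.* m → + d ≡ + x * + m - + y * + n
ℕ-identity⇒ℤ {d} x m y n eq = begin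
  + d                              ≡⟨ cancel (+ d) (+ y * + n) ⟩
  (+ d + + y * + n) - + y * + n    ≡⟨ cong (λ k → (+ d + k) - + y * + n) (sym (pos-* y n)) ⟩
  (+ d + + (y ℕ.* n)) - + y * + n  ≡⟨ cong (_- + y * + n) (sym (pos-+ d (y ℕ.* n))) ⟩
  + (d ℕ.+ y ℕ.* n) - + y * + n    ≡⟨ cong (λ k → + k - + y * + n) eq ⟩
  + (x ℕ.* m) - + y * + n          ≡⟨ cong (_- + y * + n) (pos-* x m) ⟩
  + x * + m - + y * + n            ∎
  where
  cancel : ∀ a b → a ≡ (a + b) - b
  cancel = solve-∀

bézout : ∀ i j → ∃[ σ ] ∃[ τ ] gcd i j ≡ i * σ + j * τ
bézout i j with ∣i∣≡unit*i i | ∣i∣≡unit*i j | Bézout.identity (gcd-GCD ∣ i ∣ ∣ j ∣)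
... | εᵢ , ∣i∣≡ | εⱼ , ∣j∣≡ | Bézout.+- x y eq = + x * εᵢ , - (+ y * εⱼ) , (begin
  gcd i j                               ≡⟨ ℕ-identity⇒ℤ x (∣ i ∣) y (∣ j ∣) eq ⟩
  + x * + ∣ i ∣ - + y * + ∣ j ∣          ≡⟨ cong₂ (λ p q → + x * p - + y * q) ∣i∣≡ ∣j∣≡ ⟩
  + x * (εᵢ * i) - + y * (εⱼ * j)        ≡⟨ regroup (+ x) (+ y) εᵢ εⱼ i j ⟩
  i * (+ x * εᵢ) + j * (- (+ y * εⱼ))      ∎)
  where
  regroup : ∀ p q u v i j → p * (u * i) - q * (v * j) ≡ i * (p * u) + j * (- (q * v))
  regroup = solve-∀
... | εᵢ , ∣i∣≡ | εⱼ , ∣j∣≡ | Bézout.-+ x y eq = - (+ x * εᵢ) , + y * εⱼ , (begin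
  gcd i j                               ≡⟨ ℕ-identity⇒ℤ y (∣ j ∣) x (∣ i ∣) eq ⟩
  + y * + ∣ j ∣ - + x * + ∣ i ∣          ≡⟨ cong₂ (λ p q → + y * q - + x * p) ∣i∣≡ ∣j∣≡ ⟩
  + y * (εⱼ * j) - + x * (εᵢ * i)        ≡⟨ regroup (+ y) (+ x) εⱼ εᵢ j i ⟩
  i * (- (+ x * εᵢ)) + j * (+ y * εⱼ)      ∎)
  where
  regroup : ∀ p q u v j i → p * (u * j) - q * (v * i) ≡ i * (- (q * v)) + j * (p * u)
  regroup = solve-∀

combination-*ʳ : ∀ p q s t n → p * (s * n) + q * (t * n) ≡ (p * s + q * t) * n
combination-*ʳ = solve-∀

unitri : ℤ → ℤ → ℤ → Mat3
unitri a b c zero             zero             = 1ℤ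
unitri a b c zero             (suc zero)       = a
unitri a b c zero             (suc (suc zero)) = b
unitri a b c (suc zero)       (suc zero)       = 1ℤ
unitri a b c (suc zero)       (suc (suc zero)) = c
unitri a b c (suc (suc zero)) (suc (suc zero)) = 1ℤ
unitri a b c _                _                = 0ℤ

unitri-isU3 : ∀ a b c → IsU3 (unitri a b c)
unitri-isU3 a b c = (refl , refl , refl) , (refl , refl , refl)

unitri-⊗-row₁ : ∀ a b c X j → (unitri a b c ⊗ X) i1 j ≡ X i1 j + a * X i2 j + b * X i3 j
unitri-⊗-row₁ a b c X j = cong (λ t → t + a * X i2 j + b * X i3 j) (*-identityˡ (X i1 j))

unitri-⊗-row₂ : ∀ a b c X j → (unitri a b c ⊗ X) i2 j ≡ X i2 j + c * X i3 j
unitri-⊗-row₂ a b c X j = row₂ (X i1 j) (X i2 j) (X i3 j) c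
  where
  row₂ : ∀ p q r c → 0ℤ * p + 1ℤ * q + c * r ≡ q + c * r
  row₂ = solve-∀

unitri-⊗-row₃ : ∀ a b c X j → (unitri a b c ⊗ X) i3 j ≡ X i3 j
unitri-⊗-row₃ a b c X j = row₃ (X i1 j) (X i2 j) (X i3 j)
  where
  row₃ : ∀ p q r → 0ℤ * p + 0ℤ * q + 1ℤ * r ≡ r
  row₃ = solve-∀

⊗-unitri-col₁ : ∀ X x y z i → (X ⊗ unitri x y z) i i1 ≡ X i i1
⊗-unitri-col₁ X x y z i = col₁ (X i i1) (X i i2) (X i i3)
  where
  col₁ : ∀ p q r → p * 1ℤ + q * 0ℤ + r * 0ℤ ≡ p
  col₁ = solve-∀

⊗-unitri-col₂ : ∀ X x y z i → (X ⊗ unitri x y z) i i2 ≡ X i i2 + X i i1 * x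
⊗-unitri-col₂ X x y z i = col₂ (X i i1) (X i i2) (X i i3) x
  where
  col₂ : ∀ p q r x → p * x + q * 1ℤ + r * 0ℤ ≡ q + p * x
  col₂ = solve-∀

⊗-unitri-col₃ : ∀ X x y z i → (X ⊗ unitri x y z) i i3 ≡ X i i3 + (X i i1 * y + X i i2 * z)
⊗-unitri-col₃ X x y z i = col₃ (X i i1) (X i i2) (X i i3) y z
  where
  col₃ : ∀ p q r y z → p * y + q * z + r * 1ℤ ≡ r + (p * y + q * z)
  col₃ = solve-∀

minor : Fin 3 → Fin 3 → Mat3 → ℤ
minor i k X = X i i1 * X k i2 - X i i2 * X k i1

minor-cong : ∀ {p q r s p′ q′ r′ s′} → p ≡ p′ → q ≡ q′ → r ≡ r′ → s ≡ s′ →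
             p * s - q * r ≡ p′ * s′ - q′ * r′
minor-cong p≡ q≡ r≡ s≡ = cong₂ _-_ (cong₂ _*_ p≡ s≡) (cong₂ _*_ q≡ r≡)

minor-⊗-unitri : ∀ X x y z i k → minor i k (X ⊗ unitri x y z) ≡ minor i k X
minor-⊗-unitri X x y z i k = begin
  minor i k (X ⊗ unitri x y z)
    ≡⟨ minor-cong (⊗-unitri-col₁ X x y z i) (⊗-unitri-col₂ X x y z i)
                  (⊗-unitri-col₁ X x y z k) (⊗-unitri-col₂ X x y z k) ⟩
  X i i1 * (X k i2 + X k i1 * x) - (X i i2 + X i i1 * x) * X k i1
    ≡⟨ shear (X i i1) (X i i2) (X k i1) (X k i2) x ⟩
  minor i k X ∎
  where
  shear : ∀ p q r s x → p * (s + r * x) - (q + p * x) * r ≡ p * s - q * r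
  shear = solve-∀

minor₁₃-unitri-⊗ : ∀ a b c X → minor i1 i3 (unitri a b c ⊗ X) ≡ minor i1 i3 X + a * minor i2 i3 X
minor₁₃-unitri-⊗ a b c X = begin
  minor i1 i3 (unitri a b c ⊗ X)
    ≡⟨ minor-cong (unitri-⊗-row₁ a b c X i1) (unitri-⊗-row₁ a b c X i2)
                  (unitri-⊗-row₃ a b c X i1) (unitri-⊗-row₃ a b c X i2) ⟩
  (X i1 i1 + a * X i2 i1 + b * X i3 i1) * X i3 i2 - (X i1 i2 + a * X i2 i2 + b * X i3 i2) * X i3 i1
    ≡⟨ expand (X i1 i1) (X i1 i2) (X i2 i1) (X i2 i2) (X i3 i1) (X i3 i2) a b ⟩
  minor i1 i3 X + a * minor i2 i3 X ∎
  where
  expand : ∀ p₁ q₁ p₂ q₂ p₃ q₃ a b →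
           (p₁ + a * p₂ + b * p₃) * q₃ - (q₁ + a * q₂ + b * q₃) * p₃
           ≡ (p₁ * q₃ - q₁ * p₃) + a * (p₂ * q₃ - q₂ * p₃)
  expand = solve-∀

minor₁₂-unitri-⊗ : ∀ a b c X → minor i1 i2 (unitri a b c ⊗ X)
                   ≡ minor i1 i2 X + (minor i1 i3 X * c + minor i2 i3 X * (a * c - b))
minor₁₂-unitri-⊗ a b c X = begin
  minor i1 i2 (unitri a b c ⊗ X)
    ≡⟨ minor-cong (unitri-⊗-row₁ a b c X i1) (unitri-⊗-row₁ a b c X i2)
                  (unitri-⊗-row₂ a b c X i1) (unitri-⊗-row₂ a b c X i2) ⟩
  (X i1 i1 + a * X i2 i1 + b * X i3 i1) * (X i2 i2 + c * X i3 i2)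
    - (X i1 i2 + a * X i2 i2 + b * X i3 i2) * (X i2 i1 + c * X i3 i1)
    ≡⟨ expand (X i1 i1) (X i1 i2) (X i2 i1) (X i2 i2) (X i3 i1) (X i3 i2) a b c ⟩
  minor i1 i2 X + (minor i1 i3 X * c + minor i2 i3 X * (a * c - b)) ∎
  where
  expand : ∀ p₁ q₁ p₂ q₂ p₃ q₃ a b c →
           (p₁ + a * p₂ + b * p₃) * (q₂ + c * q₃) - (q₁ + a * q₂ + b * q₃) * (p₂ + c * p₃)
           ≡ (p₁ * q₂ - q₁ * p₂) + ((p₁ * q₃ - q₁ * p₃) * c + (p₂ * q₃ - q₂ * p₃) * (a * c - b))
  expand = solve-∀

module _ (a b c x y z : ℤ) (X : Mat3) where
  private
    u = unitri a b c
    u′ = unitri x y z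

  conj-entry₃₂ : ((u ⊗ X) ⊗ u′) i3 i2 ≡ X i3 i2 + X i3 i1 * x
  conj-entry₃₂ = trans (⊗-unitri-col₂ (u ⊗ X) x y z i3)
    (cong₂ (λ p q → p + q * x) (unitri-⊗-row₃ a b c X i2) (unitri-⊗-row₃ a b c X i1))

  conj-entry₃₃ : ((u ⊗ X) ⊗ u′) i3 i3 ≡ X i3 i3 + (X i3 i1 * y + X i3 i2 * z)
  conj-entry₃₃ = trans (⊗-unitri-col₃ (u ⊗ X) x y z i3)
    (cong₂ (λ p t → p + t) (unitri-⊗-row₃ a b c X i3)
      (cong₂ (λ p q → p * y + q * z) (unitri-⊗-row₃ a b c X i1) (unitri-⊗-row₃ a b c X i2)))

  conj-minor₁₂ : M12 ((u ⊗ X) ⊗ u′) ≡ M12 X + (M13 X * c + minor i2 i3 X * (a * c - b))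
  conj-minor₁₂ = trans (minor-⊗-unitri (u ⊗ X) x y z i1 i2) (minor₁₂-unitri-⊗ a b c X)

  conj-minor₁₃ : M13 ((u ⊗ X) ⊗ u′) ≡ M13 X + a * minor i2 i3 X
  conj-minor₁₃ = trans (minor-⊗-unitri (u ⊗ X) x y z i1 i3) (minor₁₃-unitri-⊗ a b c X)

det≡cofactor-col₃ : ∀ X → det X ≡ X i1 i3 * minor i2 i3 X - X i2 i3 * minor i1 i3 X + X i3 i3 * minor i1 i2 X
det≡cofactor-col₃ X = expand (X i1 i1) (X i1 i2) (X i1 i3) (X i2 i1) (X i2 i2) (X i2 i3) (X i3 i1) (X i3 i2) (X i3 i3)
  where
  expand : ∀ x₁₁ x₁₂ x₁₃ x₂₁ x₂₂ x₂₃ x₃₁ x₃₂ x₃₃ →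
           x₁₁ * (x₂₂ * x₃₃ - x₂₃ * x₃₂) - x₁₂ * (x₂₁ * x₃₃ - x₂₃ * x₃₁) + x₁₃ * (x₂₁ * x₃₂ - x₂₂ * x₃₁)
           ≡ x₁₃ * (x₂₁ * x₃₂ - x₂₂ * x₃₁) - x₂₃ * (x₁₁ * x₃₂ - x₁₂ * x₃₁) + x₃₃ * (x₁₁ * x₂₂ - x₁₂ * x₂₁)
  expand = solve-∀

rowForm : Mat3 → ℤ → ℤ → Fin 3 → ℤ
rowForm X σ τ i = X i i1 * σ + X i i2 * τ

plücker : ∀ X σ τ → let ℓ = rowForm X σ τ in
          ℓ i2 * minor i1 i3 X - ℓ i1 * minor i2 i3 X ≡ ℓ i3 * minor i1 i2 X
plücker X = identity (X i1 i1) (X i1 i2) (X i2 i1) (X i2 i2) (X i3 i1) (X i3 i2)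
  where
  identity : ∀ p₁ q₁ p₂ q₂ p₃ q₃ σ τ →
             (p₂ * σ + q₂ * τ) * (p₁ * q₃ - q₁ * p₃) - (p₁ * σ + q₁ * τ) * (p₂ * q₃ - q₂ * p₃)
             ≡ (p₃ * σ + q₃ * τ) * (p₁ * q₂ - q₁ * p₂)
  identity = solve-∀

minor-combination : ∀ X σ τ → let ℓ = rowForm X σ τ in
                    minor i1 i3 X * (X i3 i3 * ℓ i2 - X i2 i3 * ℓ i3)
                    + minor i2 i3 X * (X i1 i3 * ℓ i3 - X i3 i3 * ℓ i1)
                    ≡ ℓ i3 * det X
minor-combination X σ τ = begin
  m₁₃ * (x₃₃ * ℓ i2 - x₂₃ * ℓ i3) + m₂₃ * (x₁₃ * ℓ i3 - x₃₃ * ℓ i1)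
    ≡⟨ regroup m₁₃ m₂₃ x₁₃ x₂₃ x₃₃ (ℓ i1) (ℓ i2) (ℓ i3) ⟩
  x₃₃ * (ℓ i2 * m₁₃ - ℓ i1 * m₂₃) + ℓ i3 * (x₁₃ * m₂₃ - x₂₃ * m₁₃)
    ≡⟨ cong (λ t → x₃₃ * t + ℓ i3 * (x₁₃ * m₂₃ - x₂₃ * m₁₃)) (plücker X σ τ) ⟩
  x₃₃ * (ℓ i3 * m₁₂) + ℓ i3 * (x₁₃ * m₂₃ - x₂₃ * m₁₃)
    ≡⟨ factor m₁₂ m₁₃ m₂₃ x₁₃ x₂₃ x₃₃ (ℓ i3) ⟩
  ℓ i3 * (x₁₃ * m₂₃ - x₂₃ * m₁₃ + x₃₃ * m₁₂)
    ≡⟨ cong (ℓ i3 *_) (sym (det≡cofactor-col₃ X)) ⟩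
  ℓ i3 * det X ∎
  where
  ℓ = rowForm X σ τ
  m₁₂ = minor i1 i2 X
  m₁₃ = minor i1 i3 X
  m₂₃ = minor i2 i3 X
  x₁₃ = X i1 i3
  x₂₃ = X i2 i3
  x₃₃ = X i3 i3
  regroup : ∀ m₁₃ m₂₃ x₁₃ x₂₃ x₃₃ ℓ₁ ℓ₂ ℓ₃ →
            m₁₃ * (x₃₃ * ℓ₂ - x₂₃ * ℓ₃) + m₂₃ * (x₁₃ * ℓ₃ - x₃₃ * ℓ₁)
            ≡ x₃₃ * (ℓ₂ * m₁₃ - ℓ₁ * m₂₃) + ℓ₃ * (x₁₃ * m₂₃ - x₂₃ * m₁₃)
  regroup = solve-∀
  factor : ∀ m₁₂ m₁₃ m₂₃ x₁₃ x₂₃ x₃₃ ℓ₃ →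
           x₃₃ * (ℓ₃ * m₁₂) + ℓ₃ * (x₁₃ * m₂₃ - x₂₃ * m₁₃) ≡ ℓ₃ * (x₁₃ * m₂₃ - x₂₃ * m₁₃ + x₃₃ * m₁₂)
  factor = solve-∀

gcd-in-minor-span : ∀ X → IsSL3 X → ∀ n →
                    ∃[ c ] ∃[ e ] minor i1 i3 X * c + minor i2 i3 X * e ≡ gcd (X i3 i1) (X i3 i2) * n
gcd-in-minor-span X det≡1 n with bézout (X i3 i1) (X i3 i2)
... | σ , τ , gcd≡ = c * n , e * n , (begin
  minor i1 i3 X * (c * n) + minor i2 i3 X * (e * n)  ≡⟨ combination-*ʳ (minor i1 i3 X) (minor i2 i3 X) c e n ⟩
  (minor i1 i3 X * c + minor i2 i3 X * e) * n        ≡⟨ cong (_* n) (minor-combination X σ τ) ⟩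
  ℓ i3 * det X * n                                   ≡⟨ cong (λ t → ℓ i3 * t * n) det≡1 ⟩
  ℓ i3 * 1ℤ * n                                      ≡⟨ cong (_* n) (*-identityʳ (ℓ i3)) ⟩
  ℓ i3 * n                                           ≡⟨ cong (_* n) (sym gcd≡) ⟩
  gcd (X i3 i1) (X i3 i2) * n                        ∎)
  where
  ℓ = rowForm X σ τ
  c = X i3 i3 * ℓ i2 - X i2 i3 * ℓ i3
  e = X i1 i3 * ℓ i3 - X i3 i3 * ℓ i1

conj-entry₃₂-shift : ∀ X a b c y z f d n → X i3 i1 ≡ f * d →
                     ((unitri a b c ⊗ X) ⊗ unitri n y z) i3 i2 ≡ X i3 i2 + f * (d * n)
conj-entry₃₂-shift X a b c y z f d n x₃₁≡ = trans (conj-entry₃₂ a b c n y z X) (cong (_+_ (X i3 i2)) (begin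
  X i3 i1 * n    ≡⟨ cong (_* n) x₃₁≡ ⟩
  f * d * n      ≡⟨ *-assoc f d n ⟩
  f * (d * n)    ∎))

conj-entry₃₃-shift : ∀ X a b c x σ τ f n → f ≡ X i3 i1 * σ + X i3 i2 * τ →
                     ((unitri a b c ⊗ X) ⊗ unitri x (σ * n) (τ * n)) i3 i3 ≡ X i3 i3 + f * n
conj-entry₃₃-shift X a b c x σ τ f n f≡ = trans (conj-entry₃₃ a b c x (σ * n) (τ * n) X) (cong (_+_ (X i3 i3)) (begin
  X i3 i1 * (σ * n) + X i3 i2 * (τ * n)  ≡⟨ combination-*ʳ (X i3 i1) (X i3 i2) σ τ n ⟩
  (X i3 i1 * σ + X i3 i2 * τ) * n        ≡⟨ cong (_* n) (sym f≡) ⟩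
  f * n                                  ∎))

conj-minor₁₂-shift : ∀ X a c e x y z f n → M13 X * c + minor i2 i3 X * e ≡ f * n →
                     M12 ((unitri a (a * c - e) c ⊗ X) ⊗ unitri x y z) ≡ M12 X + f * n
conj-minor₁₂-shift X a c e x y z f n span≡ = trans (conj-minor₁₂ a (a * c - e) c x y z X) (cong (_+_ (M12 X)) (begin
  M13 X * c + minor i2 i3 X * (a * c - (a * c - e))  ≡⟨ cong (λ t → M13 X * c + minor i2 i3 X * t) (i-[i-j]≡j (a * c) e) ⟩
  M13 X * c + minor i2 i3 X * e                      ≡⟨ span≡ ⟩
  f * n                                              ∎))
  where
  i-[i-j]≡j : ∀ i j → i - (i - j) ≡ j
  i-[i-j]≡j = solve-∀

conj-minor₁₃-shift : ∀ X a b c x y z f d → minor i2 i3 X ≡ f * d →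
                     M13 ((unitri a b c ⊗ X) ⊗ unitri x y z) ≡ M13 X + f * (d * a)
conj-minor₁₃-shift X a b c x y z f d m₂₃≡ = trans (conj-minor₁₃ a b c x y z X) (cong (_+_ (M13 X)) (begin
  a * minor i2 i3 X  ≡⟨ cong (a *_) m₂₃≡ ⟩
  a * (f * d)        ≡⟨ *-comm a (f * d) ⟩
  f * d * a          ≡⟨ *-assoc f d a ⟩
  f * (d * a)        ∎))

-- The non-vanishing hypotheses only make d₁ and d₂ well defined as quotients in the paper;
-- here they are given together with their defining equations.
lemma5p2 : (A : Mat3) → IsSL3 A → A i3 i1 ≢ 0ℤ
  → A i2 i1 * A i3 i2 - A i2 i2 * A i3 i1 ≢ 0ℤ
  → (d₁ d₂ : ℤ)
  → A i3 i1 ≡ gcd (A i3 i1) (A i3 i2) * d₁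
  → A i2 i1 * A i3 i2 - A i2 i2 * A i3 i1 ≡ gcd (A i3 i1) (A i3 i2) * d₂
  → (n₁ n₂ n₃ n₄ : ℤ)
  → ∃[ u ] ∃[ u′ ] (IsU3 u × IsU3 u′
    × ((u ⊗ A) ⊗ u′) i3 i2 ≡ A i3 i2 + gcd (A i3 i1) (A i3 i2) * (d₁ * n₁)
    × ((u ⊗ A) ⊗ u′) i3 i3 ≡ A i3 i3 + gcd (A i3 i1) (A i3 i2) * n₂
    × M12 ((u ⊗ A) ⊗ u′) ≡ M12 A + gcd (A i3 i1) (A i3 i2) * n₃
    × M13 ((u ⊗ A) ⊗ u′) ≡ M13 A + gcd (A i3 i1) (A i3 i2) * (d₂ * n₄))
lemma5p2 A det≡1 _ _ d₁ d₂ a₃₁≡ m₂₃≡ n₁ n₂ n₃ n₄ =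
  let f = gcd (A i3 i1) (A i3 i2)
      σ , τ , f≡ = bézout (A i3 i1) (A i3 i2)
      c , e , span≡ = gcd-in-minor-span A det≡1 n₃
      b = n₄ * c - e
  in unitri n₄ b c , unitri n₁ (σ * n₂) (τ * n₂) , unitri-isU3 n₄ b c , unitri-isU3 n₁ (σ * n₂) (τ * n₂) ,
     conj-entry₃₂-shift A n₄ b c (σ * n₂) (τ * n₂) f d₁ n₁ a₃₁≡ ,
     conj-entry₃₃-shift A n₄ b c n₁ σ τ f n₂ f≡ ,
     conj-minor₁₂-shift A n₄ c e n₁ (σ * n₂) (τ * n₂) f n₃ span≡ ,
     conj-minor₁₃-shift A n₄ b c n₁ (σ * n₂) (τ * n₂) f d₂ m₂₃≡
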